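{- For any $a,n\in\mathbb{N}$ and any prime $q$, $S_n(q^a)\equiv 0\pmod{q^{a-1}}$, where $S_n(m)=\sum_{i=1}^m i^n$.
   Context: $\mathbb{N}$ denotes the positive integers. $S_n(m)=1^n+2^n+\dots+m^n$. -}

module Defs where

open import Data.Nat using (ℕ; zero; suc; _+_; _^_)

S : ℕ → ℕ → ℕ
S n zero    = 0
S n (suc m) = S n m + suc m ^ n

-- Write  a ≡ b ⊕ m  for "a = b + t·m for some natural t": a one-sided
-- congruence modulo m that is convenient over ℕ.  The argument is:
--   * powerShift:  (x·m + j)^n ≡ j^n ⊕ m        (binomial expansion mod m);
--   * sumShift:    S_n(x·m + j) ≡ S_n(x·m) + S_n(j) ⊕ m, by induction on j,
--                  summing powerShift over the last j terms;
--   * sumBlocks:   S_n(k·m) ≡ k·S_n(m) ⊕ m, by induction on k using sumShift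
--                  with j = m: the range 1..k·m splits into k blocks of length m,
--                  each congruent to 1..m;
--   * sumPowerDivisible:  q^b ∣ S_n(q^(b+1)), by induction on b: with m = q^(b+1),
--                  S_n(q·m) ≡ q·S_n(m) ⊕ m and q·q^b ∣ q·S_n(m) by hypothesis.
module Submission where

open import Defs
open import Data.Nat using (ℕ; zero; suc; _+_; _*_; _^_; _∸_; _≤_)
open import Data.Nat.Divisibility using (_∣_; 1∣_; ∣m∣n⇒∣m+n; n∣m*n; *-pres-∣; ∣-refl)
open import Data.Nat.Primality using (Prime)
open import Data.Nat.Properties using (+-suc; +-comm)
open import Data.Product using (Σ-syntax; _,_)
open import Relation.Binary.PropositionalEquality
  using (_≡_; refl; sym; cong; cong₂; subst; module ≡-Reasoning)
open import Data.Nat.Solver using (module +-*-Solver)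
open +-*-Solver using (solve; _:+_; _:*_; _:=_; con)
open ≡-Reasoning

_≡_⊕_ : ℕ → ℕ → ℕ → Set
a ≡ b ⊕ m = Σ[ t ∈ ℕ ] a ≡ b + t * m

infix 4 _≡_⊕_

powerShift : ∀ m x j n → (x * m + j) ^ n ≡ j ^ n ⊕ m
powerShift m x j zero = 0 , refl
powerShift m x j (suc n) with powerShift m x j n
... | t , eq = x * j ^ n + x * t * m + j * t , (begin
    (x * m + j) * (x * m + j) ^ n ≡⟨ cong ((x * m + j) *_) eq ⟩
    (x * m + j) * (j ^ n + t * m)  ≡⟨ expand x m j (j ^ n) t ⟩
    j * j ^ n + (x * j ^ n + x * t * m + j * t) * m ∎)
  where
  expand : ∀ x m j p t →
           (x * m + j) * (p + t * m) ≡ j * p + (x * p + x * t * m + j * t) * m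
  expand = solve 5 (λ x m j p t →
    (x :* m :+ j) :* (p :+ t :* m) := j :* p :+ (x :* p :+ x :* t :* m :+ j :* t) :* m) refl

sumShift : ∀ m n x j → S n (x * m + j) ≡ S n (x * m) + S n j ⊕ m
sumShift m n x zero = 0 , (begin
    S n (x * m + 0)         ≡⟨ cong (S n) (+-comm (x * m) 0) ⟩
    S n (x * m)             ≡⟨ solve 1 (λ s → s := s :+ con 0 :+ con 0) refl (S n (x * m)) ⟩
    S n (x * m) + 0 + 0 * m ∎)
sumShift m n x (suc j) with sumShift m n x j | powerShift m x (suc j) n
... | t , eq | u , eq′ = t + u , (begin
    S n (x * m + suc j)                             ≡⟨ cong (S n) (+-suc (x * m) j) ⟩
    S n (x * m + j) + suc (x * m + j) ^ n           ≡⟨ cong₂ _+_ eq (cong (_^ n) (sym (+-suc (x * m) j))) ⟩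
    S n (x * m) + S n j + t * m + (x * m + suc j) ^ n ≡⟨ cong (S n (x * m) + S n j + t * m +_) eq′ ⟩
    S n (x * m) + S n j + t * m + (suc j ^ n + u * m) ≡⟨ regroup (S n (x * m)) (S n j) t m (suc j ^ n) u ⟩
    S n (x * m) + (S n j + suc j ^ n) + (t + u) * m ∎)
  where
  regroup : ∀ a b t m c u → a + b + t * m + (c + u * m) ≡ a + (b + c) + (t + u) * m
  regroup = solve 6 (λ a b t m c u →
    a :+ b :+ t :* m :+ (c :+ u :* m) := a :+ (b :+ c) :+ (t :+ u) :* m) refl

sumBlocks : ∀ m n k → S n (k * m) ≡ k * S n m ⊕ m
sumBlocks m n zero = 0 , refl
sumBlocks m n (suc k) with sumBlocks m n k | sumShift m n k m
... | t , eq | u , eq′ = t + u , (begin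
    S n (suc k * m)                   ≡⟨ cong (S n) (+-comm m (k * m)) ⟩
    S n (k * m + m)                   ≡⟨ eq′ ⟩
    S n (k * m) + S n m + u * m       ≡⟨ cong (λ z → z + S n m + u * m) eq ⟩
    k * S n m + t * m + S n m + u * m ≡⟨ regroup k (S n m) t m u ⟩
    suc k * S n m + (t + u) * m ∎)
  where
  regroup : ∀ k s t m u → k * s + t * m + s + u * m ≡ (1 + k) * s + (t + u) * m
  regroup = solve 5 (λ k s t m u →
    k :* s :+ t :* m :+ s :+ u :* m := (con 1 :+ k) :* s :+ (t :+ u) :* m) refl

sumPowerDivisible : ∀ n q b → q ^ b ∣ S n (q ^ suc b)
sumPowerDivisible n q zero = 1∣ S n (q ^ 1)
sumPowerDivisible n q (suc b) with sumBlocks (q ^ suc b) n q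
... | t , eq = subst (q ^ suc b ∣_) (sym eq)
    (∣m∣n⇒∣m+n (*-pres-∣ (∣-refl {q}) (sumPowerDivisible n q b))
               (n∣m*n t))

corollary4 : (a n q : ℕ) → 1 ≤ a → 1 ≤ n → Prime q →
    q ^ (a ∸ 1) ∣ S n (q ^ a)
corollary4 (suc b) n q _ _ _ = sumPowerDivisible n q b
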